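{- For every $n\ge 6$, $|\mathfrak{S}_n^{\nearrow}(123)|=0$; that is, every permutation of $[n]$ with non-decreasing nom code contains the pattern $123$.
   Context: $[n]=\{1,\dots,n\}$, $\mathfrak{S}_n$ the symmetric group on $[n]$; products of permutations are composed with the leftmost factor acting first: $(\alpha\beta)(x)=\beta(\alpha(x))$. A function $f:[n]\to[n]$ is subexceedant if $1\le f(i)\le i$ for all $i$, written $f_1\cdots f_n$; $F_n$ is the set of such functions. $\phi:F_n\to\mathfrak{S}_n$, $\phi(f)=(1,f_1)(2,f_2)\cdots(n,f_n)$ (with $(i,i)$ the identity), is a bijection, and $\phi^{ -1}(\sigma)$ is the nom code of $\sigma$. $F_n^{\nearrow}$ is the set of non-decreasing subexceedant functions on $[n]$, $\mathfrak{S}_n^{\nearrow}=\phi(F_n^{\nearrow})$. A permutation $\sigma$ contains a pattern $\pi\in\mathfrak{S}_3$ if there are $a<b<c$ with $\sigma(a)\sigma(b)\sigma(c)$ in the same relative order as $\pi(1)\pi(2)\pi(3)$, and avoids $\pi$ otherwise; $\mathfrak{S}_n^{\nearrow}(\pi)$ is the set of $\sigma\in\mathfrak{S}_n^{\nearrow}$ avoiding $\pi$. -}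

module Defs where

open import Data.Nat using (ℕ; _≤_)
open import Data.Fin using (Fin; toℕ; _≟_; _<_) renaming (_≤_ to _≤ᶠ_)
open import Data.List using (List; foldl; allFin)
open import Data.Product using (∃-syntax; _×_)
open import Relation.Nullary using (yes; no)

-- Elements of [n] are represented by Fin n (i ↦ toℕ i + 1).

transposition : ∀ {n} → Fin n → Fin n → Fin n → Fin n
transposition a b x with x ≟ a
... | yes _ = b
... | no _ with x ≟ b
...   | yes _ = a
...   | no _ = x

-- Subexceedant: 1 ≤ f(i) ≤ i  (0-indexed: toℕ (f i) ≤ toℕ i).
Subexceedant : ∀ {n} → (Fin n → Fin n) → Set
Subexceedant f = ∀ i → toℕ (f i) ≤ toℕ i

NonDecreasing : ∀ {n} → (Fin n → Fin n) → Set
NonDecreasing f = ∀ i j → i ≤ᶠ j → f i ≤ᶠ f j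

-- φ(f) = (1,f₁)(2,f₂)⋯(n,fₙ), leftmost factor acting first:
-- φ(f)(x) = tₙ(⋯ t₂(t₁(x))⋯) with tᵢ = (i,fᵢ).
phi : ∀ {n} → (Fin n → Fin n) → Fin n → Fin n
phi {n} f x = foldl (λ y i → transposition i (f i) y) x (allFin n)

Contains123 : ∀ {n} → (Fin n → Fin n) → Set
Contains123 {n} σ = ∃[ a ] ∃[ b ] ∃[ c ]
  (a < b × b < c × σ a < σ b × σ b < σ c)

-- Work on ℕ, 0-indexed, with σₖ = prefix g k = (0, g 0)(1, g 1)⋯(k-1, g (k-1)).
-- Passing from σₖ to σₖ₊₁ appends the value g k at position k and raises the
-- entry equal to g k, if any, to k.  As g k is at least the previous last value m,
-- a 123 occurrence can only be destroyed when one of its two smaller values is g k.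
-- The invariant keeps one of three situations that survive such a step: an
-- occurrence whose smaller values lie below m; an occurrence avoiding m together
-- with an earlier entry below m; or m = 0, an occurrence with values ≥ 3, and the
-- value 1 before the value 2.  It holds for all 132 admissible g at k = 6, which
-- is checked by evaluation.
module Submission where

open import Defs
open import Data.Nat using (ℕ; zero; suc; _≤_; _<_; z≤n; s≤s; _+_; _∸_)
open import Data.Nat.Properties as ℕ using (_≟_; _<?_; _≤?_; ≤ᵇ⇒≤; anyUpTo?; allUpTo?)
open import Data.Fin using (Fin; toℕ; fromℕ<) renaming (_≟_ to _≟ᶠ_)
open import Data.Fin.Properties using (toℕ-injective; toℕ<n; fromℕ<-toℕ; toℕ-fromℕ<)
open import Data.List using ([]; _∷_; foldl; allFin; upTo; map; tabulate; applyUpTo; _∷ʳ_)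
open import Data.List.Properties using (foldl-∷ʳ; foldl-map; upTo-∷ʳ; map-tabulate)
open import Data.Product using (∃-syntax; _×_; _,_)
open import Data.Sum using (_⊎_; inj₁; inj₂)
open import Data.Unit using (⊤; tt)
open import Function using (_∘_; id)
open import Relation.Nullary using (Dec; yes; no; contradiction)
open import Relation.Nullary.Decidable using (_×-dec_; _⊎-dec_; _→-dec_; toWitness; ¬?; map′)
open import Relation.Binary.PropositionalEquality

-- Opaque so that unifying prefix terms never unfolds swap; only the base case computes with it.
opaque
  swap : ℕ → ℕ → ℕ → ℕ
  swap a b y with y ≟ a
  ... | yes _ = b
  ... | no _ with y ≟ b
  ...   | yes _ = a
  ...   | no _ = y

  swap-left : ∀ a b → swap a b a ≡ b
  swap-left a b with a ≟ a
  ... | yes _ = refl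
  ... | no a≢a = contradiction refl a≢a

  swap-right : ∀ {a b y} → y ≢ a → y ≡ b → swap a b y ≡ a
  swap-right {a} {b} {y} y≢a y≡b with y ≟ a
  ... | yes y≡a = contradiction y≡a y≢a
  ... | no _ with y ≟ b
  ...   | yes _ = refl
  ...   | no y≢b = contradiction y≡b y≢b

  swap-other : ∀ {a b y} → y ≢ a → y ≢ b → swap a b y ≡ y
  swap-other {a} {b} {y} y≢a y≢b with y ≟ a
  ... | yes y≡a = contradiction y≡a y≢a
  ... | no _ with y ≟ b
  ...   | yes y≡b = contradiction y≡b y≢b
  ...   | no _ = refl

toℕ-transposition : ∀ {n} (a b x : Fin n) →
  toℕ (transposition a b x) ≡ swap (toℕ a) (toℕ b) (toℕ x)
toℕ-transposition a b x with x ≟ᶠ a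
... | yes refl = sym (swap-left (toℕ x) (toℕ b))
... | no x≢a with x ≟ᶠ b
...   | yes refl = sym (swap-right (x≢a ∘ toℕ-injective) refl)
...   | no x≢b = sym (swap-other (x≢a ∘ toℕ-injective) (x≢b ∘ toℕ-injective))

prefix : (ℕ → ℕ) → ℕ → ℕ → ℕ
prefix g zero x = x
prefix g (suc k) x = swap k (g k) (prefix g k x)

foldl-swaps-upTo : ∀ g k x → foldl (λ y i → swap i (g i) y) x (upTo k) ≡ prefix g k x
foldl-swaps-upTo g zero x = refl
foldl-swaps-upTo g (suc k) x = begin
    foldl step x (upTo (suc k))  ≡⟨ cong (foldl step x) (sym (upTo-∷ʳ k)) ⟩
    foldl step x (upTo k ∷ʳ k)   ≡⟨ foldl-∷ʳ step x k (upTo k) ⟩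
    swap k (g k) (foldl step x (upTo k))  ≡⟨ cong (swap k (g k)) (foldl-swaps-upTo g k x) ⟩
    prefix g (suc k) x  ∎
  where
  open ≡-Reasoning
  step : ℕ → ℕ → ℕ
  step y i = swap i (g i) y

foldl-fusion : ∀ {A B C : Set} (h : A → B) {s : A → C → A} {t : B → C → B} →
  (∀ a c → h (s a c) ≡ t (h a) c) → ∀ a xs → h (foldl s a xs) ≡ foldl t (h a) xs
foldl-fusion h fuse a [] = refl
foldl-fusion h {s} {t} fuse a (c ∷ xs) =
  trans (foldl-fusion h fuse (s a c) xs) (cong (λ b → foldl t b xs) (fuse a c))

tabulate-∘toℕ : ∀ {A : Set} (h : ℕ → A) n → tabulate {n = n} (h ∘ toℕ) ≡ applyUpTo h n
tabulate-∘toℕ h zero = refl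
tabulate-∘toℕ h (suc n) = cong (h 0 ∷_) (tabulate-∘toℕ (h ∘ suc) n)

map-toℕ-allFin : ∀ n → map toℕ (allFin n) ≡ upTo n
map-toℕ-allFin n = trans (map-tabulate id toℕ) (tabulate-∘toℕ id n)

toℕ-phi : ∀ {n} (f : Fin n → Fin n) (g : ℕ → ℕ) → (∀ i → g (toℕ i) ≡ toℕ (f i)) →
  ∀ x → toℕ (phi f x) ≡ prefix g n (toℕ x)
toℕ-phi {n} f g g≗f x = begin
    toℕ (phi f x)
  ≡⟨ foldl-fusion toℕ swap-toℕ x (allFin n) ⟩
    foldl (λ y i → step y (toℕ i)) (toℕ x) (allFin n)
  ≡⟨ sym (foldl-map step toℕ (toℕ x) (allFin n)) ⟩
    foldl step (toℕ x) (map toℕ (allFin n))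
  ≡⟨ cong (foldl step (toℕ x)) (map-toℕ-allFin n) ⟩
    foldl step (toℕ x) (upTo n)
  ≡⟨ foldl-swaps-upTo g n (toℕ x) ⟩
    prefix g n (toℕ x)  ∎
  where
  open ≡-Reasoning
  step : ℕ → ℕ → ℕ
  step y i = swap i (g i) y
  swap-toℕ : ∀ y i → toℕ (transposition i (f i) y) ≡ step (toℕ y) (toℕ i)
  swap-toℕ y i = trans (toℕ-transposition i (f i) y) (cong (λ v → swap (toℕ i) v (toℕ y)) (sym (g≗f i)))

module PrefixOfSubexceedant (g : ℕ → ℕ) (g≤id : ∀ i → g i ≤ i) where

  prefix-fixes-≥ : ∀ k x → k ≤ x → prefix g k x ≡ x
  prefix-fixes-≥ zero x _ = refl
  prefix-fixes-≥ (suc k) x k<x rewrite prefix-fixes-≥ k x (ℕ.<⇒≤ k<x) =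
    swap-other (ℕ.>⇒≢ k<x) (ℕ.>⇒≢ (ℕ.≤-<-trans (g≤id k) k<x))

  prefix-suc-last : ∀ k → prefix g (suc k) k ≡ g k
  prefix-suc-last k rewrite prefix-fixes-≥ k k ℕ.≤-refl = swap-left k (g k)

  prefix-< : ∀ k x → x < k → prefix g k x < k
  prefix-< (suc k) x x<1+k with ℕ.m≤n⇒m<n∨m≡n (ℕ.≤-pred x<1+k)
  ... | inj₂ refl rewrite prefix-suc-last x = s≤s (g≤id x)
  ... | inj₁ x<k with prefix g k x ≟ g k
  ...   | yes y≡gk rewrite swap-right (ℕ.<⇒≢ (prefix-< k x x<k)) y≡gk = ℕ.n<1+n k
  ...   | no y≢gk rewrite swap-other (ℕ.<⇒≢ (prefix-< k x x<k)) y≢gk =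
    ℕ.m<n⇒m<1+n (prefix-< k x x<k)

  prefix-suc-stable : ∀ k x → x < k → prefix g k x ≢ g k → prefix g (suc k) x ≡ prefix g k x
  prefix-suc-stable k x x<k = swap-other (ℕ.<⇒≢ (prefix-< k x x<k))

  prefix-suc-≥ : ∀ k x → x < k → prefix g k x ≤ prefix g (suc k) x
  prefix-suc-≥ k x x<k with prefix g k x ≟ g k
  ... | no y≢gk rewrite prefix-suc-stable k x x<k y≢gk = ℕ.≤-refl
  ... | yes y≡gk rewrite swap-right (ℕ.<⇒≢ (prefix-< k x x<k)) y≡gk = ℕ.<⇒≤ (prefix-< k x x<k)

Pattern123 : (ℕ → ℕ) → ℕ → (ℕ → ℕ → Set) → Set
Pattern123 σ k Q = ∃[ c ] (c < k × ∃[ b ] (b < c × ∃[ a ] (a < b ×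
  σ a < σ b × σ b < σ c × Q (σ a) (σ b))))

Below : ℕ → (ℕ → ℕ) → ℕ → Set
Below k σ m = Pattern123 σ k (λ _ y → y < m)

Apart : ℕ → (ℕ → ℕ) → ℕ → Set
Apart k σ m = Pattern123 σ k (λ x y → x ≢ m × y ≢ m) × ∃[ p ] (suc p < k × σ p < m)

AboveTwo : ℕ → (ℕ → ℕ) → Set
AboveTwo k σ = Pattern123 σ k (λ x _ → 3 ≤ x) × ∃[ q ] (q < k × ∃[ p ] (p < q × σ p ≡ 1 × σ q ≡ 2))

Invariant : ℕ → (ℕ → ℕ) → ℕ → Set
Invariant k σ m = Below k σ m ⊎ Apart k σ m ⊎ (m ≡ 0 × AboveTwo k σ)

avoids-below-3 : ∀ {v x y} → v < 3 → x < y → 3 ≤ x → x ≢ v × y ≢ v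
avoids-below-3 v<3 x<y 3≤x = ℕ.>⇒≢ (ℕ.<-≤-trans v<3 3≤x) ,
  ℕ.>⇒≢ (ℕ.<-≤-trans v<3 (ℕ.≤-trans 3≤x (ℕ.<⇒≤ x<y)))

module Extension (σ σ' : ℕ → ℕ) (j m m' : ℕ)
  (σ-last : σ j ≡ m) (σ'-last : σ' (suc j) ≡ m')
  (σ'-stable : ∀ x → x < suc j → σ x ≢ m' → σ' x ≡ σ x)
  (σ'-≥ : ∀ x → x < suc j → σ x ≤ σ' x) (m≤m' : m ≤ m') where

  transport : ∀ {Q Q' : ℕ → ℕ → Set} →
    (∀ {x y} → x < y → Q x y → x ≢ m' × y ≢ m') → (∀ {x y} → x < y → Q x y → Q' x y) →
    Pattern123 σ (suc j) Q → Pattern123 σ' (suc (suc j)) Q'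
  transport {Q} {Q'} avoid weaken (c , c<k , b , b<c , a , a<b , σa<σb , σb<σc , q)
    with avoid σa<σb q
  ... | (σa≢m' , σb≢m') = c , ℕ.m<n⇒m<1+n c<k , b , b<c , a , a<b ,
        subst₂ _<_ (sym a-stable) (sym b-stable) σa<σb ,
        subst (_< σ' c) (sym b-stable) (ℕ.<-≤-trans σb<σc (σ'-≥ c c<k)) ,
        subst₂ Q' (sym a-stable) (sym b-stable) (weaken σa<σb q)
    where
    b<k = ℕ.<-trans b<c c<k
    a-stable = σ'-stable a (ℕ.<-trans a<b b<k) σa≢m'
    b-stable = σ'-stable b b<k σb≢m'

  stable-value : ∀ {x v} → x < suc j → σ x ≡ v → v ≢ m' → σ' x ≡ v
  stable-value x<k σx≡v v≢m' = trans (σ'-stable _ x<k (λ e → v≢m' (trans (sym σx≡v) e))) σx≡v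

  occurrence-before-last : ∀ {p q} → p < q → q < suc j → σ' p < σ' q → σ' q < m' →
    Below (suc (suc j)) σ' m'
  occurrence-before-last p<q q<k σ'p<σ'q σ'q<m' =
    suc j , ℕ.≤-refl , _ , q<k , _ , p<q , σ'p<σ'q , subst (_ <_) (sym σ'-last) σ'q<m' , σ'q<m'

  invariant-step : Invariant (suc j) σ m → Invariant (suc (suc j)) σ' m'
  invariant-step (inj₁ below) = inj₁ (transport
    (λ x<y y<m → ℕ.<⇒≢ (ℕ.<-≤-trans (ℕ.<-trans x<y y<m) m≤m') , ℕ.<⇒≢ (ℕ.<-≤-trans y<m m≤m'))
    (λ _ y<m → ℕ.<-≤-trans y<m m≤m') below)
  invariant-step (inj₂ (inj₁ (apart , p , 1+p<k , σp<m))) with ℕ.m≤n⇒m<n∨m≡n m≤m'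
  ... | inj₂ refl = inj₂ (inj₁ (transport (λ _ → id) (λ _ → id) apart ,
        p , ℕ.m<n⇒m<1+n 1+p<k , subst (_< m) (sym σ'p≡σp) σp<m))
    where
    σ'p≡σp = stable-value (ℕ.<-trans (ℕ.n<1+n p) 1+p<k) refl (ℕ.<⇒≢ σp<m)
  ... | inj₁ m<m' = inj₁ (occurrence-before-last (ℕ.≤-pred 1+p<k) ℕ.≤-refl
        (subst₂ _<_ (sym σ'p≡σp) (sym σ'j≡m) σp<m) (subst (_< m') (sym σ'j≡m) m<m'))
    where
    σ'p≡σp = stable-value (ℕ.<-trans (ℕ.n<1+n p) 1+p<k) refl (ℕ.<⇒≢ (ℕ.<-trans σp<m m<m'))
    σ'j≡m = stable-value ℕ.≤-refl σ-last (ℕ.<⇒≢ m<m')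
  invariant-step (inj₂ (inj₂ (refl , above , q , q<k , p , p<q , σp≡1 , σq≡2)))
    with m' ≟ 0 | 3 ≤? m'
  ... | yes refl | _ = inj₂ (inj₂ (refl , transport (avoids-below-3 (s≤s z≤n)) (λ _ → id) above ,
        q , ℕ.m<n⇒m<1+n q<k , p , p<q ,
        stable-value p<k σp≡1 (λ ()) , stable-value q<k σq≡2 (λ ())))
    where p<k = ℕ.<-trans p<q q<k
  ... | no m'≢0 | yes 3≤m' = inj₁ (occurrence-before-last p<q q<k
        (subst₂ _<_ (sym σ'p≡1) (sym σ'q≡2) ℕ.≤-refl) (subst (_< m') (sym σ'q≡2) 3≤m'))
    where
    σ'p≡1 = stable-value (ℕ.<-trans p<q q<k) σp≡1 (ℕ.<⇒≢ (ℕ.≤-trans (s≤s (s≤s z≤n)) 3≤m'))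
    σ'q≡2 = stable-value q<k σq≡2 (ℕ.<⇒≢ 3≤m')
  ... | no m'≢0 | no 3≰m' = inj₂ (inj₁ (transport (avoids-below-3 3>m') (avoids-below-3 3>m') above ,
        j , ℕ.≤-refl , subst (_< m') (sym σ'j≡0) (ℕ.n≢0⇒n>0 m'≢0)))
    where
    3>m' = ℕ.≰⇒> 3≰m'
    σ'j≡0 = stable-value ℕ.≤-refl σ-last (≢-sym m'≢0)

occurrence : ∀ {k σ m} → Invariant k σ m → Pattern123 σ k (λ _ _ → ⊤)
occurrence (inj₁ (c , c<k , b , b<c , a , a<b , σa<σb , σb<σc , _)) =
  c , c<k , b , b<c , a , a<b , σa<σb , σb<σc , tt
occurrence (inj₂ (inj₁ ((c , c<k , b , b<c , a , a<b , σa<σb , σb<σc , _) , _))) =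
  c , c<k , b , b<c , a , a<b , σa<σb , σb<σc , tt
occurrence (inj₂ (inj₂ (_ , (c , c<k , b , b<c , a , a<b , σa<σb , σb<σc , _) , _))) =
  c , c<k , b , b<c , a , a<b , σa<σb , σb<σc , tt

Pattern123? : ∀ σ k {Q : ℕ → ℕ → Set} → (∀ x y → Dec (Q x y)) → Dec (Pattern123 σ k Q)
Pattern123? σ k Q? = anyUpTo? (λ c → anyUpTo? (λ b → anyUpTo? (λ a →
  (σ a <? σ b) ×-dec (σ b <? σ c) ×-dec Q? (σ a) (σ b)) b) c) k

Invariant? : ∀ k σ m → Dec (Invariant k σ m)
Invariant? k σ m =
  Pattern123? σ k (λ _ y → y <? m)
  ⊎-dec (Pattern123? σ k (λ x y → ¬? (x ≟ m) ×-dec ¬? (y ≟ m)) ×-dec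
         map′ (λ (p , _ , r) → p , r) (λ (p , 1+p<k , σp<m) → p , ℕ.<-trans (ℕ.n<1+n p) 1+p<k , 1+p<k , σp<m)
              (anyUpTo? (λ p → (suc p <? k) ×-dec (σ p <? m)) k))
  ⊎-dec ((m ≟ 0) ×-dec Pattern123? σ k (λ x _ → 3 ≤? x) ×-dec
         anyUpTo? (λ q → anyUpTo? (λ p → (σ p ≟ 1) ×-dec (σ q ≟ 2)) q) k)

table : ℕ → ℕ → ℕ → ℕ → ℕ → ℕ → ℕ → ℕ
table v₀ v₁ v₂ v₃ v₄ v₅ 0 = v₀
table v₀ v₁ v₂ v₃ v₄ v₅ 1 = v₁
table v₀ v₁ v₂ v₃ v₄ v₅ 2 = v₂
table v₀ v₁ v₂ v₃ v₄ v₅ 3 = v₃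
table v₀ v₁ v₂ v₃ v₄ v₅ 4 = v₄
table v₀ v₁ v₂ v₃ v₄ v₅ _ = v₅

BaseTable : Set
BaseTable = ∀ {v₀} → v₀ < 1 → ∀ {v₁} → v₁ < 2 → ∀ {v₂} → v₂ < 3 →
  ∀ {v₃} → v₃ < 4 → ∀ {v₄} → v₄ < 5 → ∀ {v₅} → v₅ < 6 →
  v₀ ≤ v₁ → v₁ ≤ v₂ → v₂ ≤ v₃ → v₃ ≤ v₄ → v₄ ≤ v₅ →
  Invariant 6 (prefix (table v₀ v₁ v₂ v₃ v₄ v₅) 6) v₅

opaque
  unfolding swap

  baseTable : BaseTable
  baseTable = toWitness {a? = BaseTable?} tt
    where
      BaseTable? : Dec BaseTable
      BaseTable? =
        allUpTo? (λ v₀ → allUpTo? (λ v₁ → allUpTo? (λ v₂ →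
        allUpTo? (λ v₃ → allUpTo? (λ v₄ → allUpTo? (λ v₅ →
          (v₀ ≤? v₁) →-dec (v₁ ≤? v₂) →-dec (v₂ ≤? v₃) →-dec (v₃ ≤? v₄) →-dec (v₄ ≤? v₅) →-dec
          Invariant? 6 (prefix (table v₀ v₁ v₂ v₃ v₄ v₅) 6) v₅) 6) 5) 4) 3) 2) 1

-- prefix g 6 only inspects g 0, …, g 5, so it agrees definitionally with the tabulated case.
invariant-base : ∀ g → (∀ i → g i ≤ i) → (∀ i → i < 5 → g i ≤ g (suc i)) →
  Invariant 6 (prefix g 6) (g 5)
invariant-base g g≤id g≤g∘suc =
  baseTable (s≤s (g≤id 0)) (s≤s (g≤id 1)) (s≤s (g≤id 2))
            (s≤s (g≤id 3)) (s≤s (g≤id 4)) (s≤s (g≤id 5))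
            (g≤g∘suc 0 (≤ᵇ⇒≤ 1 5 tt)) (g≤g∘suc 1 (≤ᵇ⇒≤ 2 5 tt)) (g≤g∘suc 2 (≤ᵇ⇒≤ 3 5 tt))
            (g≤g∘suc 3 (≤ᵇ⇒≤ 4 5 tt)) (g≤g∘suc 4 ℕ.≤-refl)

module NomCode {n : ℕ} (f : Fin n → Fin n) where

  extend : ℕ → ℕ
  extend i with i <? n
  ... | yes i<n = toℕ (f (fromℕ< i<n))
  ... | no _ = 0

  extend-toℕ : ∀ i → extend (toℕ i) ≡ toℕ (f i)
  extend-toℕ i with toℕ i <? n
  ... | yes i<n = cong (toℕ ∘ f) (fromℕ<-toℕ i i<n)
  ... | no i≮n = contradiction (toℕ<n i) i≮n

  extend-≤ : Subexceedant f → ∀ i → extend i ≤ i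
  extend-≤ sub i with i <? n
  ... | yes i<n = subst (toℕ (f (fromℕ< i<n)) ≤_) (toℕ-fromℕ< i<n) (sub (fromℕ< i<n))
  ... | no _ = z≤n

  extend-mono : NonDecreasing f → ∀ {i j} → i ≤ j → j < n → extend i ≤ extend j
  extend-mono mono {i} {j} i≤j j<n with i <? n | j <? n
  ... | yes i<n | yes _ = mono (fromℕ< i<n) (fromℕ< j<n)
          (subst₂ _≤_ (sym (toℕ-fromℕ< i<n)) (sym (toℕ-fromℕ< j<n)) i≤j)
  ... | no i≮n | _ = contradiction (ℕ.≤-<-trans i≤j j<n) i≮n
  ... | _ | no j≮n = contradiction j<n j≮n

  toℕ-phi-fromℕ< : ∀ {x} (x<n : x < n) → toℕ (phi f (fromℕ< x<n)) ≡ prefix extend n x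
  toℕ-phi-fromℕ< x<n =
    trans (toℕ-phi f extend extend-toℕ (fromℕ< x<n)) (cong (prefix extend n) (toℕ-fromℕ< x<n))

  contains123 : ∀ {Q} → Pattern123 (prefix extend n) n Q → Contains123 (phi f)
  contains123 (c , c<n , b , b<c , a , a<b , σa<σb , σb<σc , _) =
    fromℕ< a<n , fromℕ< b<n , fromℕ< c<n ,
    subst₂ _<_ (sym (toℕ-fromℕ< a<n)) (sym (toℕ-fromℕ< b<n)) a<b ,
    subst₂ _<_ (sym (toℕ-fromℕ< b<n)) (sym (toℕ-fromℕ< c<n)) b<c ,
    subst₂ _<_ (sym (toℕ-phi-fromℕ< a<n)) (sym (toℕ-phi-fromℕ< b<n)) σa<σb ,
    subst₂ _<_ (sym (toℕ-phi-fromℕ< b<n)) (sym (toℕ-phi-fromℕ< c<n)) σb<σc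
    where
    b<n = ℕ.<-trans b<c c<n
    a<n = ℕ.<-trans a<b b<n

prefix-invariant : ∀ g → (∀ i → g i ≤ i) → ∀ {n} → (∀ {i j} → i ≤ j → j < n → g i ≤ g j) →
  ∀ d → 6 + d ≤ n → Invariant (6 + d) (prefix g (6 + d)) (g (5 + d))
prefix-invariant g g≤id g-mono zero 6≤n =
  invariant-base g g≤id (λ i i<5 → g-mono (ℕ.n≤1+n i) (ℕ.<-≤-trans (s≤s i<5) 6≤n))
prefix-invariant g g≤id g-mono (suc d) 7+d≤n = Extension.invariant-step
  (prefix g (6 + d)) (prefix g (7 + d)) (5 + d) (g (5 + d)) (g (6 + d))
  (prefix-suc-last (5 + d)) (prefix-suc-last (6 + d))
  (prefix-suc-stable (6 + d)) (prefix-suc-≥ (6 + d))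
  (g-mono (ℕ.n≤1+n _) 7+d≤n)
  (prefix-invariant g g≤id g-mono d (ℕ.<⇒≤ 7+d≤n))
  where open PrefixOfSubexceedant g g≤id

proposition5p1 : (n : ℕ) → 6 ≤ n → (f : Fin n → Fin n) →
    Subexceedant f → NonDecreasing f → Contains123 (phi f)
proposition5p1 n 6≤n f sub mono =
  contains123 (subst (λ k → Pattern123 (prefix extend k) k (λ _ _ → ⊤)) 6+[n∸6]≡n
    (occurrence (prefix-invariant extend (extend-≤ sub) (extend-mono mono) (n ∸ 6) (ℕ.≤-reflexive 6+[n∸6]≡n))))
  where
  open NomCode f
  6+[n∸6]≡n : 6 + (n ∸ 6) ≡ n
  6+[n∸6]≡n = ℕ.m+[n∸m]≡n 6≤n
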